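{- Let $A$ be a non-empty set of atoms. The five equational axioms of $\mathrm{EqMSCL}$, namely (Neg) $\mathsf F=\neg\mathsf T$, (Or) $x\lor_s y=\neg(\neg x\land_s\neg y)$, (Tand) $\mathsf T\land_s x=x$, (Abs) $x\land_s(x\lor_s y)=x$, (Mem) $(x\lor_s y)\land_s z=(\neg x\land_s(y\land_s z))\lor_s(x\land_s z)$, are independent: none of them is derivable in equational logic from the other four.
   Context: Terms are built over the signature $\Sigma_{SCL}(A)=\{\land_s,\lor_s,\neg,\mathsf T,\mathsf F\}\cup A$, where each atom $a\in A$ is a constant, $\mathsf T,\mathsf F$ are constants, $\neg$ is unary and $\land_s,\lor_s$ (sequential, i.e. short-circuit, conjunction and disjunction) are binary, together with variables $x,y,z,\dots$. Derivability is derivability in equational logic (substitution, reflexivity, symmetry, transitivity, congruence). -}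

module Defs where

open import Data.Nat using (ℕ)
open import Data.Product using (_×_; _,_)
open import Relation.Binary.PropositionalEquality using (_≡_)
open import Relation.Nullary using (¬_)

data Term (A : Set) : Set where
  var  : ℕ → Term A
  atom : A → Term A
  T    : Term A
  F    : Term A
  neg  : Term A → Term A
  _∧s_ : Term A → Term A → Term A
  _∨s_ : Term A → Term A → Term A

infixr 6 _∧s_
infixr 5 _∨s_

_[_] : ∀ {A} → Term A → (ℕ → Term A) → Term A
var n    [ σ ] = σ n
atom a   [ σ ] = atom a
T        [ σ ] = T
F        [ σ ] = F
neg t    [ σ ] = neg (t [ σ ])
(s ∧s t) [ σ ] = (s [ σ ]) ∧s (t [ σ ])
(s ∨s t) [ σ ] = (s [ σ ]) ∨s (t [ σ ])

data Axiom : Set where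
  Neg Or Tand Abs Mem : Axiom

x y z : ∀ {A} → Term A
x = var 0
y = var 1
z = var 2

axiomEq : ∀ {A} → Axiom → Term A × Term A
axiomEq Neg  = F , neg T
axiomEq Or   = x ∨s y , neg (neg x ∧s neg y)
axiomEq Tand = T ∧s x , x
axiomEq Abs  = x ∧s (x ∨s y) , x
axiomEq Mem  = (x ∨s y) ∧s z , (neg x ∧s (y ∧s z)) ∨s (x ∧s z)

data _⊢_≈_ {A : Set} (Γ : Axiom → Set) : Term A → Term A → Set where
  ax    : ∀ {e s t} → Γ e → axiomEq e ≡ (s , t) → Γ ⊢ s ≈ t
  subst : ∀ {s t} (σ : ℕ → Term A) → Γ ⊢ s ≈ t → Γ ⊢ (s [ σ ]) ≈ (t [ σ ])
  refl  : ∀ {s} → Γ ⊢ s ≈ s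
  sym   : ∀ {s t} → Γ ⊢ s ≈ t → Γ ⊢ t ≈ s
  trans : ∀ {s t u} → Γ ⊢ s ≈ t → Γ ⊢ t ≈ u → Γ ⊢ s ≈ u
  cong¬ : ∀ {s t} → Γ ⊢ s ≈ t → Γ ⊢ neg s ≈ neg t
  cong∧ : ∀ {s s' t t'} → Γ ⊢ s ≈ s' → Γ ⊢ t ≈ t' → Γ ⊢ (s ∧s t) ≈ (s' ∧s t')
  cong∨ : ∀ {s s' t t'} → Γ ⊢ s ≈ s' → Γ ⊢ t ≈ t' → Γ ⊢ (s ∨s t) ≈ (s' ∨s t')

Others : Axiom → (Axiom → Set)
Others e e' = ¬ (e' ≡ e)

Independent : (A : Set) → Axiom → Set
Independent A e = let (l , r) = axiomEq {A} e in ¬ (Others e ⊢ l ≈ r)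

-- Equational logic is sound: if every axiom of Γ holds in an algebra
-- for the signature (under all valuations), then so does every equation
-- derivable from Γ.  Hence, to show that axiom e is not derivable from
-- the other four, it suffices to exhibit an algebra in which the other
-- four axioms hold but e fails.
--
-- For each axiom e we give a two-element algebra that
-- "separates" e; since Axiom is finite, the five separation claims form
-- a single decidable proposition, checked by evaluation.

module Submission where

open import Defs
open import Data.Bool using (Bool; true; false; not; _∧_; _∨_; _xor_)
import Data.Bool.Properties as Bool
open import Data.Fin using (Fin; zero; suc)
import Data.Fin.Properties as Fin
open import Data.Nat using (ℕ)
open import Data.Product using (_×_; _,_; proj₁; proj₂)
open import Function using (_∘_)
open import Relation.Binary.Definitions using (DecidableEquality)
open import Relation.Nullary using (¬_; Dec)
open import Relation.Nullary.Decidable using (map′; _×-dec_; _→-dec_; ¬?; from-yes)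
open import Relation.Binary.PropositionalEquality as Eq using (_≡_; cong; cong₂)
open Eq.≡-Reasoning

record Algebra (A : Set) : Set₁ where
  field
    Carrier      : Set
    ⟦atom⟧       : A → Carrier
    ⟦T⟧ ⟦F⟧      : Carrier
    ⟦neg⟧        : Carrier → Carrier
    ⟦and⟧ ⟦or⟧   : Carrier → Carrier → Carrier

module Semantics {A : Set} (𝔄 : Algebra A) where
  open Algebra 𝔄

  Valuation : Set
  Valuation = ℕ → Carrier

  ⟦_⟧ : Term A → Valuation → Carrier
  ⟦ var n  ⟧ ρ = ρ n
  ⟦ atom a ⟧ ρ = ⟦atom⟧ a
  ⟦ T      ⟧ ρ = ⟦T⟧
  ⟦ F      ⟧ ρ = ⟦F⟧
  ⟦ neg t  ⟧ ρ = ⟦neg⟧ (⟦ t ⟧ ρ)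
  ⟦ s ∧s t ⟧ ρ = ⟦and⟧ (⟦ s ⟧ ρ) (⟦ t ⟧ ρ)
  ⟦ s ∨s t ⟧ ρ = ⟦or⟧ (⟦ s ⟧ ρ) (⟦ t ⟧ ρ)

  ⟦⟧-[] : ∀ t σ ρ → ⟦ t [ σ ] ⟧ ρ ≡ ⟦ t ⟧ (λ n → ⟦ σ n ⟧ ρ)
  ⟦⟧-[] (var n)  σ ρ = Eq.refl
  ⟦⟧-[] (atom a) σ ρ = Eq.refl
  ⟦⟧-[] T        σ ρ = Eq.refl
  ⟦⟧-[] F        σ ρ = Eq.refl
  ⟦⟧-[] (neg t)  σ ρ = cong ⟦neg⟧ (⟦⟧-[] t σ ρ)
  ⟦⟧-[] (s ∧s t) σ ρ = cong₂ ⟦and⟧ (⟦⟧-[] s σ ρ) (⟦⟧-[] t σ ρ)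
  ⟦⟧-[] (s ∨s t) σ ρ = cong₂ ⟦or⟧ (⟦⟧-[] s σ ρ) (⟦⟧-[] t σ ρ)

  _≐_ : Term A → Term A → Set
  s ≐ t = ∀ ρ → ⟦ s ⟧ ρ ≡ ⟦ t ⟧ ρ

  Holds : Axiom → Set
  Holds e = let (l , r) = axiomEq {A} e in l ≐ r

  sound : ∀ {Γ : Axiom → Set} → (∀ e → Γ e → Holds e) →
          ∀ {s t} → Γ ⊢ s ≈ t → s ≐ t
  sound h (ax {e} γ Eq.refl) = h e γ
  sound h (subst {s} {t} σ d) ρ = begin
    ⟦ s [ σ ] ⟧ ρ              ≡⟨ ⟦⟧-[] s σ ρ ⟩
    ⟦ s ⟧ (λ n → ⟦ σ n ⟧ ρ)    ≡⟨ sound h d (λ n → ⟦ σ n ⟧ ρ) ⟩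
    ⟦ t ⟧ (λ n → ⟦ σ n ⟧ ρ)    ≡⟨ ⟦⟧-[] t σ ρ ⟨
    ⟦ t [ σ ] ⟧ ρ              ∎
  sound h refl        ρ = Eq.refl
  sound h (sym d)     ρ = Eq.sym (sound h d ρ)
  sound h (trans d e) ρ = Eq.trans (sound h d ρ) (sound h e ρ)
  sound h (cong¬ d)   ρ = cong ⟦neg⟧ (sound h d ρ)
  sound h (cong∧ d e) ρ = cong₂ ⟦and⟧ (sound h d ρ) (sound h e ρ)
  sound h (cong∨ d e) ρ = cong₂ ⟦or⟧ (sound h d ρ) (sound h e ρ)

module AxiomFinite where
  index : Axiom → Fin 5
  index Neg  = zero
  index Or   = suc zero
  index Tand = suc (suc zero)
  index Abs  = suc (suc (suc zero))
  index Mem  = suc (suc (suc (suc zero)))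

  fromIndex : Fin 5 → Axiom
  fromIndex zero                         = Neg
  fromIndex (suc zero)                   = Or
  fromIndex (suc (suc zero))             = Tand
  fromIndex (suc (suc (suc zero)))       = Abs
  fromIndex (suc (suc (suc (suc zero)))) = Mem

  fromIndex-index : ∀ e → fromIndex (index e) ≡ e
  fromIndex-index Neg  = Eq.refl
  fromIndex-index Or   = Eq.refl
  fromIndex-index Tand = Eq.refl
  fromIndex-index Abs  = Eq.refl
  fromIndex-index Mem  = Eq.refl

  index-injective : ∀ {e e'} → index e ≡ index e' → e ≡ e'
  index-injective {e} {e'} eq = begin
    e                     ≡⟨ fromIndex-index e ⟨
    fromIndex (index e)   ≡⟨ cong fromIndex eq ⟩
    fromIndex (index e')  ≡⟨ fromIndex-index e' ⟩
    e'                    ∎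

  _≟_ : DecidableEquality Axiom
  e ≟ e' = map′ index-injective (cong index) (index e Fin.≟ index e')

  ∀? : {P : Axiom → Set} → (∀ e → Dec (P e)) → Dec (∀ e → P e)
  ∀? {P} P? = map′ (λ h e → Eq.subst P (fromIndex-index e) (h (index e)))
                   (λ h → h ∘ fromIndex)
                   (Fin.all? (P? ∘ fromIndex))

∀-Bool? : {P : Bool → Set} → (∀ b → Dec (P b)) → Dec (∀ b → P b)
∀-Bool? P? = map′ (λ { (pt , pf) true → pt ; (pt , pf) false → pf })
                  (λ h → h true , h false)
                  (P? true ×-dec P? false)

record BoolOps : Set where
  field
    opT opF       : Bool
    opNeg         : Bool → Bool
    opAnd opOr    : Bool → Bool → Bool

twoElement : ∀ {A} → BoolOps → Algebra A
twoElement ops = record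
  { Carrier = Bool ; ⟦atom⟧ = λ _ → false ; ⟦T⟧ = opT ; ⟦F⟧ = opF
  ; ⟦neg⟧ = opNeg ; ⟦and⟧ = opAnd ; ⟦or⟧ = opOr }
  where open BoolOps ops

module TruthTables {A : Set} (ops : BoolOps) where
  open Semantics (twoElement {A} ops)

  xyz : Bool → Bool → Bool → Valuation
  xyz a b c 0 = a
  xyz a b c 1 = b
  xyz a b c _ = c

  Valid : Axiom → Set
  Valid e = let (l , r) = axiomEq {A} e in
            ∀ a b c → ⟦ l ⟧ (xyz a b c) ≡ ⟦ r ⟧ (xyz a b c)

  valid? : ∀ e → Dec (Valid e)
  valid? e = ∀-Bool? λ a → ∀-Bool? λ b → ∀-Bool? λ c →
             ⟦ proj₁ (axiomEq e) ⟧ (xyz a b c) Bool.≟ ⟦ proj₂ (axiomEq e) ⟧ (xyz a b c)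

  -- The axioms mention only x, y, z, so a valuation ρ acts on them as
  -- the row (ρ 0, ρ 1, ρ 2): truth-table validity is validity.
  valid⇒holds : ∀ e → Valid e → Holds e
  valid⇒holds Neg  v ρ = v (ρ 0) (ρ 1) (ρ 2)
  valid⇒holds Or   v ρ = v (ρ 0) (ρ 1) (ρ 2)
  valid⇒holds Tand v ρ = v (ρ 0) (ρ 1) (ρ 2)
  valid⇒holds Abs  v ρ = v (ρ 0) (ρ 1) (ρ 2)
  valid⇒holds Mem  v ρ = v (ρ 0) (ρ 1) (ρ 2)

  holds⇒valid : ∀ e → Holds e → Valid e
  holds⇒valid e h a b c = h (xyz a b c)

  Separates : Axiom → Set
  Separates e = (∀ e' → Others e e' → Valid e') × ¬ Valid e

  separates? : ∀ e → Dec (Separates e)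
  separates? e = AxiomFinite.∀? (λ e' → ¬? (e' AxiomFinite.≟ e) →-dec valid? e')
                 ×-dec ¬? (valid? e)

counterModel : Axiom → BoolOps
-- ¬ is negation but ∧s, ∨s are swapped and F = T = false:  F ≠ ¬T.
counterModel Neg  = record { opT = false ; opF = false ; opNeg = not
                           ; opAnd = _∨_ ; opOr = _∧_ }
-- ∨s is the first projection, ¬ is constantly false:  x = 1 gives 1 ≠ 0.
counterModel Or   = record { opT = false ; opF = false ; opNeg = λ _ → false
                           ; opAnd = λ _ b → b ; opOr = λ a _ → a }
-- a ∧s b = a ∧ ¬b and T = false:  T ∧s x = 0 ≠ x for x = 1.
counterModel Tand = record { opT = false ; opF = false ; opNeg = λ _ → false
                           ; opAnd = λ a b → a ∧ not b ; opOr = λ _ _ → false }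
-- ∧s and ∨s are the second projection:  x ∧s (x ∨s y) = y ≠ x.
counterModel Abs  = record { opT = false ; opF = false ; opNeg = λ a → a
                           ; opAnd = λ _ b → b ; opOr = λ _ b → b }
-- ∧s is exclusive or, ∨s is constantly false:  z = 1 gives 1 ≠ 0.
counterModel Mem  = record { opT = false ; opF = false ; opNeg = λ _ → false
                           ; opAnd = _xor_ ; opOr = λ _ _ → false }

counterModel-separates : ∀ {A} e → TruthTables.Separates {A} (counterModel e) e
counterModel-separates {A} =
  from-yes (AxiomFinite.∀? λ e → TruthTables.separates? {A} (counterModel e) e)

theorem3p3 : (A : Set) → A → (e : Axiom) → Independent A e
theorem3p3 A _ e derivation = e-fails (holds⇒valid e e-holds)
  where
    open TruthTables {A} (counterModel e)
    open Semantics (twoElement {A} (counterModel e))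

    others-valid : ∀ e' → Others e e' → Valid e'
    others-valid = proj₁ (counterModel-separates e)

    e-fails : ¬ Valid e
    e-fails = proj₂ (counterModel-separates e)

    e-holds : Holds e
    e-holds = sound (λ e' o → valid⇒holds e' (others-valid e' o)) derivation
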